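{- Let $H=\boxtimes_{i=1}^nH_i$ be a connected (not necessarily thin) strong product graph, and let $(x,y)\in E(H)$ with $|S_H(x)|=|S_H(y)|=1$. Then there is a path from $x$ to $y$ in $H$ consisting only of Cartesian edges $(u,w)$ with $|S_H(u)|=|S_H(w)|=1$.
   Context: All graphs are finite, simple, undirected. The strong product $\boxtimes_iH_i$ has vertex set $\times_iV(H_i)$; distinct vertices are adjacent iff in each coordinate they are equal or adjacent. An edge is Cartesian (with respect to this product representation) if its endpoints differ in exactly one coordinate. For $x\in V(H)$, $S_H(x)=\{v\in V(H): N^H[v]=N^H[x]\}$, where $N^H[v]$ is the closed neighborhood of $v$ in $H$. -}

module Defs where

open import Data.Nat using (ℕ)
open import Data.Fin using (Fin)
open import Data.Product using (Σ; _×_)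
open import Data.Sum using (_⊎_)
open import Data.List using (List; []; _∷_)
open import Data.List.Relation.Unary.AllPairs using (AllPairs)
open import Relation.Nullary using (¬_)
open import Relation.Binary.PropositionalEquality using (_≡_)

record Graph : Set₁ where
  field
    size   : ℕ
    Adj    : Fin size → Fin size → Set
    sym    : ∀ {u v} → Adj u v → Adj v u
    irrefl : ∀ {v} → ¬ Adj v v

open Graph public

module StrongProduct {m : ℕ} (H : Fin m → Graph) where

  Vertex : Set
  Vertex = (i : Fin m) → Fin (size (H i))

  _≈_ : Vertex → Vertex → Set
  x ≈ y = ∀ i → x i ≡ y i

  Adjᴴ : Vertex → Vertex → Set
  Adjᴴ x y = (¬ x ≈ y) × (∀ i → (x i ≡ y i) ⊎ Adj (H i) (x i) (y i))

  Cartesian : Vertex → Vertex → Set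
  Cartesian x y = Σ (Fin m) λ i → (¬ x i ≡ y i) × (∀ j → ¬ j ≡ i → x j ≡ y j)

  InClosedNbhd : Vertex → Vertex → Set
  InClosedNbhd v w = (w ≈ v) ⊎ Adjᴴ v w

  SameClosedNbhd : Vertex → Vertex → Set
  SameClosedNbhd v x = ∀ w → (InClosedNbhd v w → InClosedNbhd x w) × (InClosedNbhd x w → InClosedNbhd v w)

  S : Vertex → Vertex → Set
  S x v = SameClosedNbhd v x

  HasExactlyOne : (Vertex → Set) → Set
  HasExactlyOne P = Σ Vertex λ a → P a × (∀ v → P v → v ≈ a)

  data Walk (E : Vertex → Vertex → Set) : Vertex → Vertex → Set where
    stop : ∀ {x y} → x ≈ y → Walk E x y
    step : ∀ {x z y} → E x z → Walk E z y → Walk E x y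

  vertices : ∀ {E x y} → Walk E x y → List Vertex
  vertices (stop {x} _) = x ∷ []
  vertices (step {x} _ w) = x ∷ vertices w

  Path : (Vertex → Vertex → Set) → Vertex → Vertex → Set
  Path E x y = Σ (Walk E x y) λ w → AllPairs (λ a b → ¬ a ≈ b) (vertices w)

  Connected : Set
  Connected = ∀ u v → Path Adjᴴ u v

  GoodEdge : Vertex → Vertex → Set
  GoodEdge u w = Adjᴴ u w × Cartesian u w × HasExactlyOne (S u) × HasExactlyOne (S w)

-- A vertex of a strong product has no twin other than itself iff each of its
-- coordinates has no twin in its factor, because closed neighbourhoods of the
-- product are products of closed neighbourhoods of the factors.  Hence if x and
-- y are adjacent and twinless, every vertex whose coordinates are taken from x
-- or from y is twinless, and replacing the coordinates of x by those of y one
-- at a time gives a path of Cartesian edges between such vertices.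
module Submission where

open import Defs hiding (sym)
open import Data.Nat using (ℕ; zero; suc; _≤_; z≤n)
open import Data.Nat.Properties using (≤-refl; ≤-reflexive; ≤-trans; n≤1+n; m≤n⇒m<n∨m≡n; <⇒≱)
open import Data.Fin using (Fin; toℕ; fromℕ<; _≟_)
open import Data.Fin.Properties using (all?; toℕ<n; toℕ-fromℕ<; toℕ-injective)
open import Data.Product using (Σ; _×_; _,_; proj₁; proj₂)
open import Data.Sum using (_⊎_; inj₁; inj₂)
open import Data.Empty using (⊥-elim)
open import Data.List.Relation.Unary.All using (All; []; _∷_) renaming (map to All-map)
open import Data.List.Relation.Unary.AllPairs using (AllPairs; []; _∷_)
open import Function using (_∘_)
open import Relation.Nullary using (¬_; yes; no)
open import Relation.Binary.PropositionalEquality using (_≡_; _≢_; refl; sym; trans; subst)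
open Relation.Binary.PropositionalEquality.≡-Reasoning

module _ {m : ℕ} (H : Fin m → Graph) where
  open StrongProduct H

  Coord : Fin m → Set
  Coord i = Fin (size (H i))

  ClosedAdj : ∀ i → Coord i → Coord i → Set
  ClosedAdj i a b = a ≡ b ⊎ Adj (H i) a b

  SameClosedNbhdᵢ : ∀ i → Coord i → Coord i → Set
  SameClosedNbhdᵢ i a b = ∀ c → (ClosedAdj i a c → ClosedAdj i b c) × (ClosedAdj i b c → ClosedAdj i a c)

  Twinless : ∀ i → Coord i → Set
  Twinless i a = ∀ b → SameClosedNbhdᵢ i a b → b ≡ a

  TwinlessCoords : Vertex → Set
  TwinlessCoords z = ∀ i → Twinless i (z i)

  _⊆ᴺ_ : Vertex → Vertex → Set
  p ⊆ᴺ q = ∀ w → InClosedNbhd p w → InClosedNbhd q w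

  inClosedNbhd⇒closedAdj : ∀ {v w} → InClosedNbhd v w → ∀ i → ClosedAdj i (v i) (w i)
  inClosedNbhd⇒closedAdj (inj₁ w≈v) i = inj₁ (sym (w≈v i))
  inClosedNbhd⇒closedAdj (inj₂ (_ , v∼w)) = v∼w

  closedAdj⇒inClosedNbhd : ∀ {v w} → (∀ i → ClosedAdj i (v i) (w i)) → InClosedNbhd v w
  closedAdj⇒inClosedNbhd {v} {w} v∼w with all? (λ i → w i ≟ v i)
  ... | yes w≈v = inj₁ w≈v
  ... | no w≉v  = inj₂ ((λ v≈w → w≉v (λ i → sym (v≈w i))) , v∼w)

  sameClosedNbhd-refl : ∀ z → SameClosedNbhd z z
  sameClosedNbhd-refl z w = (λ p → p) , (λ p → p)

  update : Vertex → (i : Fin m) → Coord i → Vertex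
  update z i a j with j ≟ i
  ... | yes refl = a
  ... | no _     = z j

  update-same : ∀ z i a → update z i a i ≡ a
  update-same z i a with i ≟ i
  ... | yes refl = refl
  ... | no i≢i   = ⊥-elim (i≢i refl)

  update-other : ∀ z i a j → j ≢ i → update z i a j ≡ z j
  update-other z i a j j≢i with j ≟ i
  ... | yes refl = ⊥-elim (j≢i refl)
  ... | no _     = refl

  update-elim : ∀ (P : ∀ j → Coord j → Set) z i a →
                P i a → (∀ j → j ≢ i → P j (z j)) → ∀ j → P j (update z i a j)
  update-elim P z i a Pa Pz j with j ≟ i
  ... | yes refl = Pa
  ... | no j≢i   = Pz j j≢i

  ⊆ᴺ-fromCoordinate : ∀ {p q} i → (∀ c → ClosedAdj i (p i) c → ClosedAdj i (q i) c) →
                      (∀ j → j ≢ i → p j ≡ q j) → p ⊆ᴺ q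
  ⊆ᴺ-fromCoordinate {p} {q} i pᵢ⊆qᵢ p≡q w w∈N[p] = closedAdj⇒inClosedNbhd q∼w
    where
    q∼w : ∀ j → ClosedAdj j (q j) (w j)
    q∼w j with j ≟ i
    ... | yes refl = pᵢ⊆qᵢ (w j) (inClosedNbhd⇒closedAdj w∈N[p] j)
    ... | no j≢i   = subst (λ t → ClosedAdj j t (w j)) (p≡q j j≢i) (inClosedNbhd⇒closedAdj w∈N[p] j)

  ⊆ᴺ-coordinate : ∀ {p q} → p ⊆ᴺ q → ∀ i c → ClosedAdj i (p i) c → ClosedAdj i (q i) c
  ⊆ᴺ-coordinate {p} {q} p⊆q i c pᵢ∼c =
    subst (ClosedAdj i (q i)) (update-same p i c) (inClosedNbhd⇒closedAdj (p⊆q w w∈N[p]) i)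
    where
    w : Vertex
    w = update p i c
    w∈N[p] : InClosedNbhd p w
    w∈N[p] = closedAdj⇒inClosedNbhd (update-elim (λ j → ClosedAdj j (p j)) p i c pᵢ∼c (λ _ _ → inj₁ refl))

  sameClosedNbhd-update : ∀ x i u → SameClosedNbhdᵢ i (x i) u → SameClosedNbhd (update x i u) x
  sameClosedNbhd-update x i u xᵢ≃u w =
      ⊆ᴺ-fromCoordinate i (λ c → proj₂ (xᵢ≃u c) ∘ subst (λ t → ClosedAdj i t c) (update-same x i u))
                          (update-other x i u) w
    , ⊆ᴺ-fromCoordinate i (λ c → subst (λ t → ClosedAdj i t c) (sym (update-same x i u)) ∘ proj₁ (xᵢ≃u c))
                          (λ j j≢i → sym (update-other x i u j j≢i)) w

  uniqueTwin⇒twinlessCoords : ∀ {x} → HasExactlyOne (S x) → TwinlessCoords x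
  uniqueTwin⇒twinlessCoords {x} (a , _ , unique) i u xᵢ≃u = begin
    u                ≡⟨ sym (update-same x i u) ⟩
    update x i u i   ≡⟨ unique (update x i u) (sameClosedNbhd-update x i u xᵢ≃u) i ⟩
    a i              ≡⟨ sym (unique x (sameClosedNbhd-refl x) i) ⟩
    x i              ∎

  twinlessCoords⇒uniqueTwin : ∀ {z} → TwinlessCoords z → HasExactlyOne (S z)
  twinlessCoords⇒uniqueTwin {z} twinless = z , sameClosedNbhd-refl z , twin≈z
    where
    twin≈z : ∀ v → S z v → v ≈ z
    twin≈z v v≃z i = twinless i (v i) λ c →
      ⊆ᴺ-coordinate (proj₂ ∘ v≃z) i c , ⊆ᴺ-coordinate (proj₁ ∘ v≃z) i c

  goodEdge-update : ∀ {z} i a → TwinlessCoords z → Twinless i a →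
                    z i ≢ a → ClosedAdj i (z i) a → GoodEdge z (update z i a)
  goodEdge-update {z} i a z-twinless a-twinless zᵢ≢a zᵢ∼a =
      ((λ z≈z' → zᵢ≢z'ᵢ (z≈z' i)) , update-elim (λ j → ClosedAdj j (z j)) z i a zᵢ∼a (λ _ _ → inj₁ refl))
    , (i , zᵢ≢z'ᵢ , λ j j≢i → sym (update-other z i a j j≢i))
    , twinlessCoords⇒uniqueTwin z-twinless
    , twinlessCoords⇒uniqueTwin (update-elim Twinless z i a a-twinless (λ j _ → z-twinless j))
    where
    zᵢ≢z'ᵢ : z i ≢ update z i a i
    zᵢ≢z'ᵢ e = zᵢ≢a (trans e (update-same z i a))

  module _ (y : Vertex) (y-twinless : TwinlessCoords y) where

    AgreesFrom : ℕ → Vertex → Set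
    AgreesFrom k v = ∀ j → k ≤ toℕ j → v j ≡ y j

    Admissible : Vertex → Set
    Admissible z = ∀ j → Twinless j (z j) × ClosedAdj j (z j) (y j)

    -- Recording AgreesFrom k along the path is what makes its vertices distinct: the
    -- vertex prepended at stage suc k still differs from y in coordinate k.
    GoodPathAgreeingFrom : ℕ → Vertex → Set
    GoodPathAgreeingFrom k z =
      Σ (Walk GoodEdge z y) λ w → AllPairs (λ a b → ¬ a ≈ b) (vertices w) × All (AgreesFrom k) (vertices w)

    agreesFrom-suc : ∀ {k v} → AgreesFrom k v → AgreesFrom (suc k) v
    agreesFrom-suc {k} agree j k<j = agree j (≤-trans (n≤1+n k) k<j)

    agreesFrom-pred : ∀ {k v} i → toℕ i ≡ k → v i ≡ y i → AgreesFrom (suc k) v → AgreesFrom k v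
    agreesFrom-pred i i≡k vᵢ≡yᵢ agree j k≤j with m≤n⇒m<n∨m≡n k≤j
    ... | inj₁ k<j = agree j k<j
    ... | inj₂ k≡j with toℕ-injective {i = i} {j = j} (trans i≡k k≡j)
    ... | refl = vᵢ≡yᵢ

    agreesFrom-update : ∀ {k z} i → toℕ i ≡ k → AgreesFrom (suc k) z → AgreesFrom k (update z i (y i))
    agreesFrom-update {k} {z} i i≡k agree j =
      update-elim (λ j c → k ≤ toℕ j → c ≡ y j) z i (y i) (λ _ → refl) agreeOff j
      where
      agreeOff : ∀ j → j ≢ i → k ≤ toℕ j → z j ≡ y j
      agreeOff j j≢i k≤j with m≤n⇒m<n∨m≡n k≤j
      ... | inj₁ k<j = agree j k<j
      ... | inj₂ k≡j = ⊥-elim (j≢i (toℕ-injective (trans (sym k≡j) (sym i≡k))))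

    goodPath-suc : ∀ k i → toℕ i ≡ k →
                   (∀ z → AgreesFrom k z → Admissible z → GoodPathAgreeingFrom k z) →
                   ∀ z → AgreesFrom (suc k) z → Admissible z → GoodPathAgreeingFrom (suc k) z
    goodPath-suc k i i≡k goodPath z agree admissible with z i ≟ y i
    ... | yes zᵢ≡yᵢ =
      let (w , distinct , agreeing) = goodPath z (agreesFrom-pred i i≡k zᵢ≡yᵢ agree) admissible
      in w , distinct , All-map agreesFrom-suc agreeing
    ... | no zᵢ≢yᵢ =
      let (w , distinct , agreeing) = goodPath z' (agreesFrom-update i i≡k agree) admissible'
      in  step edge w
        , All-map (λ agreeᵥ z≈v → zᵢ≢yᵢ (trans (z≈v i) (agreeᵥ i (≤-reflexive (sym i≡k))))) agreeing ∷ distinct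
        , agree ∷ All-map agreesFrom-suc agreeing
      where
      z' : Vertex
      z' = update z i (y i)
      admissible' : Admissible z'
      admissible' = update-elim (λ j c → Twinless j c × ClosedAdj j c (y j)) z i (y i)
                                (y-twinless i , inj₁ refl) (λ j _ → admissible j)
      edge : GoodEdge z z'
      edge = goodEdge-update i (y i) (proj₁ ∘ admissible) (y-twinless i) zᵢ≢yᵢ (proj₂ (admissible i))

    goodPath : ∀ k → k ≤ m → ∀ z → AgreesFrom k z → Admissible z → GoodPathAgreeingFrom k z
    goodPath zero _ z agree _ = stop (λ j → agree j z≤n) , [] ∷ [] , agree ∷ []
    goodPath (suc k) k<m =
      goodPath-suc k (fromℕ< k<m) (toℕ-fromℕ< k<m) (goodPath k (≤-trans (n≤1+n k) k<m))

lemma3p20 : (m : ℕ) (H : Fin m → Graph) → StrongProduct.Connected H →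
    (x y : StrongProduct.Vertex H) → StrongProduct.Adjᴴ H x y →
    StrongProduct.HasExactlyOne H (StrongProduct.S H x) →
    StrongProduct.HasExactlyOne H (StrongProduct.S H y) →
    StrongProduct.Path H (StrongProduct.GoodEdge H) x y
lemma3p20 m H _ x y (_ , x∼y) x-unique y-unique =
  let (w , distinct , _) = goodPath H y (uniqueTwin⇒twinlessCoords H y-unique) m ≤-refl x
                             (λ j m≤j → ⊥-elim (<⇒≱ (toℕ<n j) m≤j))
                             (λ j → uniqueTwin⇒twinlessCoords H x-unique j , x∼y j)
  in w , distinct
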